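{- Let $G=G(V,E)$ be a connected bipartite simple graph with $|V|=n$, with bipartite orientations $O_{\text{down}}$ and $O_{\text{up}}$, and let $O$ be an acyclic orientation of $E$. Then there exists an injective function $\Theta$ from the set of linear extensions of $O$ to the set of linear extensions of $O_{\text{up}}$, and furthermore $\Theta$ is surjective if and only if $O=O_{\text{up}}$ or $O=O_{\text{down}}$.
   Context: If $V=V_1\sqcup V_2$ is a bipartition of $G$, the two bipartite orientations are the orientation choosing $(v_1,v_2)$ for every edge $\{v_1,v_2\}\in E$ with $v_1\in V_1,v_2\in V_2$, and the orientation choosing $(v_2,v_1)$ for every such edge. An acyclic orientation $O$ of $E$ induces a partial order on $V$ in which $u<v$ iff there is a directed path from $u$ to $v$ in $O$. A linear extension of $O$ is a bijection $f:V\to[n]$ with $f(u)<f(v)$ whenever $(u,v)$ is a directed edge of $O$. -}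

module Defs where

open import Data.Nat using (ℕ)
open import Data.Fin using (Fin; _<_)
open import Data.Bool using (Bool; true; false; _∧_; _∨_; not)
open import Data.Product using (Σ; _×_; ∃)
open import Data.Sum using (_⊎_)
open import Relation.Binary.PropositionalEquality using (_≡_; _≢_)
open import Relation.Nullary using (¬_)
open import Function.Definitions using (Bijective)

record SimpleGraph (n : ℕ) : Set where
  field
    adj    : Fin n → Fin n → Bool
    sym    : ∀ u v → adj u v ≡ adj v u
    irrefl : ∀ v → adj v v ≡ false

open SimpleGraph public

data Walk {n : ℕ} (G : SimpleGraph n) : Fin n → Fin n → Set where
  nil  : ∀ {v} → Walk G v v
  cons : ∀ {u v w} → adj G u v ≡ true → Walk G v w → Walk G u w

Connected : {n : ℕ} → SimpleGraph n → Set
Connected G = ∀ u v → Walk G u v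

-- A bipartition V = V₁ ⊔ V₂ given by a colouring: V₁ = col⁻¹(false),
-- V₂ = col⁻¹(true); every edge joins V₁ and V₂.
IsBipartition : {n : ℕ} → SimpleGraph n → (Fin n → Bool) → Set
IsBipartition G col = ∀ u v → adj G u v ≡ true → col u ≢ col v

DiRel : ℕ → Set
DiRel n = Fin n → Fin n → Bool

IsOrientation : {n : ℕ} → SimpleGraph n → DiRel n → Set
IsOrientation G O =
  (∀ u v → O u v ≡ true → adj G u v ≡ true) ×
  (∀ u v → adj G u v ≡ true → (O u v ≡ true) ⊎ (O v u ≡ true)) ×
  (∀ u v → O u v ≡ true → O v u ≡ false)

data DPath {n : ℕ} (O : DiRel n) : Fin n → Fin n → Set where
  edge : ∀ {u v} → O u v ≡ true → DPath O u v
  step : ∀ {u v w} → O u v ≡ true → DPath O v w → DPath O u w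

IsAcyclic : {n : ℕ} → DiRel n → Set
IsAcyclic O = ∀ v → ¬ DPath O v v

IsAcyclicOrientation : {n : ℕ} → SimpleGraph n → DiRel n → Set
IsAcyclicOrientation G O = IsOrientation G O × IsAcyclic O

-- The two bipartite orientations w.r.t. the bipartition col.
-- O_up directs every edge from V₁ (col = false) to V₂ (col = true);
-- O_down directs every edge from V₂ to V₁.
Oup : {n : ℕ} → SimpleGraph n → (Fin n → Bool) → DiRel n
Oup G col u v = adj G u v ∧ not (col u) ∧ col v

Odown : {n : ℕ} → SimpleGraph n → (Fin n → Bool) → DiRel n
Odown G col u v = adj G u v ∧ col u ∧ not (col v)

_≐_ : {n : ℕ} → DiRel n → DiRel n → Set
O ≐ O' = ∀ u v → O u v ≡ O' u v

-- Linear extensions of O: bijections f : V → [n] (here [n] = Fin n)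
-- with f u < f v for every directed edge (u,v) of O.
IsLinearExtension : {n : ℕ} → DiRel n → (Fin n → Fin n) → Set
IsLinearExtension O f = Bijective _≡_ _≡_ f × (∀ u v → O u v ≡ true → f u < f v)

LinExt : {n : ℕ} → DiRel n → Set
LinExt {n} O = Σ (Fin n → Fin n) (IsLinearExtension O)

-- Two linear extensions are the same element of the set of linear
-- extensions iff the underlying functions agree.
_≈LE_ : {n : ℕ} {O O' : DiRel n} → LinExt O → LinExt O' → Set
_≈LE_ {n} a b = ∀ (v : Fin n) → Data.Product.proj₁ a v ≡ Data.Product.proj₁ b v

WellDefined : {n : ℕ} {O O' : DiRel n} → (LinExt O → LinExt O') → Set
WellDefined {O = O} Θ = ∀ (a b : LinExt O) → a ≈LE b → Θ a ≈LE Θ b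

InjectiveLE : {n : ℕ} {O O' : DiRel n} → (LinExt O → LinExt O') → Set
InjectiveLE {O = O} Θ = ∀ (a b : LinExt O) → Θ a ≈LE Θ b → a ≈LE b

SurjectiveLE : {n : ℕ} {O O' : DiRel n} → (LinExt O → LinExt O') → Set
SurjectiveLE {O = O} {O'} Θ = ∀ (b : LinExt O') → ∃ λ (a : LinExt O) → Θ a ≈LE b

module Submission where

-- The linear extensions of O inject into those of Oup,
-- surjectively exactly when O is Oup or Odown.
--
-- The proof is by counting.  For a relation O and a vertex set U, extCount O k U
-- counts the listings of U in which each vertex follows its O-predecessors; it
-- is computed by choosing the first (a minimal) vertex, and equally, for
-- irreflexive O, the last (a maximal) one.  For h = extCount Oup we prove a
-- Hall-type neighbourhood inequality, and from it an independent-set bound: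
-- summed over the vertices x of an independent set I ⊆ U, the Oup-listings of
-- U ∖ x are at most as many as those of U.  The maximal vertices of any
-- orientation are independent, so extCount O ≤ h, strictly if O has a path
-- u → v → w; an orientation of a connected bipartite graph without such paths
-- is Oup or Odown, and Odown has as many linear extensions as Oup.  Finally the
-- listings of all vertices enumerate the linear extensions, so Θ is induced by
-- the inclusion of Fin (extCount O n ⊤) into Fin (h n ⊤), and it is surjective
-- iff the two counts agree.

open import Defs hiding (sym)
open import Data.Nat using (ℕ; zero; suc; _+_; _≤_; _<_; z≤n; s≤s)
open import Data.Nat.Properties hiding (_≟_)
open import Algebra.Properties.CommutativeMonoid.Sum +-0-commutativeMonoid
  using (sum; sum-cong-≗; ∑-distrib-+; ∑-comm; sum-replicate-zero)
open import Data.Fin using (Fin; zero; suc; _≟_; toℕ; fromℕ<; inject≤) renaming (_<_ to _<ᶠ_)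
open import Data.Fin.Properties
  using (any?; toℕ-inject≤; toℕ-fromℕ<; toℕ-injective; toℕ<n; injective⇒≤)
import Data.Fin.Properties as Fin
open import Data.Fin.Subset using (Subset; ⊤; ∣_∣)
open import Data.Fin.Subset.Properties using (∣⊤∣≡n)
open import Data.Vec using (Vec; []; _∷_; lookup; tabulate; _[_]≔_)
open import Data.Vec.Properties
  using (lookup∘updateAt; lookup∘updateAt′; []≔-commutes; lookup-replicate;
         ∷-injective; lookup∘tabulate; tabulate∘lookup; tabulate-cong)
open import Data.List using (List; []; _∷_; _++_; map; length)
import Data.List as List
open import Data.List.Properties using (length-++; length-map)
open import Data.List.Membership.Propositional using (_∈_)
open import Data.List.Membership.Propositional.Properties
  using (∈-map⁻; ∈-map⁺; ∈-++⁻; ∈-++⁺ˡ; ∈-++⁺ʳ; ∈-lookup)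
open import Data.List.Relation.Unary.Any using (here)
import Data.List.Relation.Unary.Any as Any
open import Data.List.Relation.Unary.Any.Properties using (lookup-index)
open import Data.List.Relation.Unary.All using ([])
import Data.List.Relation.Unary.All as All
open import Data.List.Relation.Unary.AllPairs using ([]; _∷_)
open import Data.List.Relation.Unary.Unique.Propositional using (Unique)
import Data.List.Relation.Unary.Unique.Propositional.Properties as Unique
open import Data.Bool using (Bool; true; false; _∧_; _∨_; not; _xor_; if_then_else_)
open import Data.Bool.Properties
  using (∧-conicalˡ; ∧-conicalʳ; ∧-comm; ∧-zeroʳ; ∧-identityʳ; ∨-zeroʳ; ∨-conicalˡ; ∨-conicalʳ;
         not-involutive; not-injective; ¬-not; ⇔→≡)
import Data.Bool.Properties as Bool
open import Data.Product using (Σ; _×_; _,_; ∃; proj₁; proj₂)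
open import Data.Sum using (_⊎_; inj₁; inj₂)
open import Data.Empty using (⊥; ⊥-elim)
open import Function using (flip)
open import Function.Bundles using (_⇔_; mk⇔)
open import Relation.Binary.PropositionalEquality
open import Relation.Binary.Definitions using (tri<; tri≈; tri>)
open import Relation.Nullary using (¬_; yes; no; ¬?)
open import Relation.Nullary.Decidable using (_×-dec_)

true≢false : true ≢ false
true≢false ()

∧-elim : ∀ {a b} → a ∧ b ≡ true → a ≡ true × b ≡ true
∧-elim {a} {b} e = ∧-conicalˡ a b e , ∧-conicalʳ a b e

∧-intro : ∀ {a b} → a ≡ true → b ≡ true → a ∧ b ≡ true
∧-intro refl refl = refl

∨-elim : ∀ {a b} → a ∨ b ≡ true → a ≡ true ⊎ b ≡ true
∨-elim {true}  e = inj₁ refl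
∨-elim {false} e = inj₂ e

∨-introˡ : ∀ {a} b → a ≡ true → a ∨ b ≡ true
∨-introˡ b refl = refl

∨-introʳ : ∀ a {b} → b ≡ true → a ∨ b ≡ true
∨-introʳ a refl = ∨-zeroʳ a

∧-not-elim : ∀ {a b} → a ∧ not b ≡ true → a ≡ true × b ≡ false
∧-not-elim {true} {false} refl = refl , refl

∧-not-intro : ∀ {a b} → a ≡ true → b ≡ false → a ∧ not b ≡ true
∧-not-intro refl refl = refl

false-if : ∀ {b} → ¬ (b ≡ true) → b ≡ false
false-if {false} _ = refl
false-if {true}  f = ⊥-elim (f refl)

ind : Bool → ℕ → ℕ
ind true  x = x
ind false x = 0

ind-≤ : ∀ b x → ind b x ≤ x
ind-≤ true  x = ≤-refl
ind-≤ false x = z≤n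

ind-mono : ∀ b {x y} → (b ≡ true → x ≤ y) → ind b x ≤ ind b y
ind-mono true  f = f refl
ind-mono false f = z≤n

ind-⊆ : ∀ {a b} → (a ≡ true → b ≡ true) → ∀ x → ind a x ≤ ind b x
ind-⊆ {false} f x = z≤n
ind-⊆ {true}  f x rewrite f refl = ≤-refl

ind-∧ : ∀ a b x → ind a (ind b x) ≡ ind (a ∧ b) x
ind-∧ true  b x = refl
ind-∧ false b x = refl

ind-∨ : ∀ a b x → (a ≡ true → b ≡ false) → ind (a ∨ b) x ≡ ind a x + ind b x
ind-∨ true  b x d rewrite d refl = sym (+-identityʳ x)
ind-∨ false b x d = refl

ind-cases : ∀ a b {y z w} → y ≤ z → (a ≡ false → b ≡ true → y ≤ w) →
            (a ≡ false → b ≡ false → y ≡ 0) → y ≤ ind a z + ind b w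
ind-cases true  b y≤z _ _ = ≤-trans y≤z (m≤m+n _ _)
ind-cases false true  _ y≤w _ = y≤w refl refl
ind-cases false false _ _ y≡0 = ≤-reflexive (y≡0 refl refl)

ind-sum : ∀ {m} b (f : Fin m → ℕ) → ind b (sum f) ≡ sum (λ i → ind b (f i))
ind-sum true  f = refl
ind-sum {m} false f = sym (sum-replicate-zero m)

sum-mono : ∀ {m} {f g : Fin m → ℕ} → (∀ i → f i ≤ g i) → sum f ≤ sum g
sum-mono {zero}  le = z≤n
sum-mono {suc m} le = +-mono-≤ (le zero) (sum-mono (λ i → le (suc i)))

sum-mono-< : ∀ {m} {f g : Fin m → ℕ} → (∀ i → f i ≤ g i) → ∀ j → f j < g j → sum f < sum g
sum-mono-< le zero    lt = +-mono-<-≤ lt (sum-mono (λ i → le (suc i)))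
sum-mono-< le (suc j) lt = +-mono-≤-< (le zero) (sum-mono-< (λ i → le (suc i)) j lt)

sumOn : ∀ {m} → (Fin m → Bool) → (Fin m → ℕ) → ℕ
sumOn P f = sum (λ x → ind (P x) (f x))

sumOn-cong : ∀ {m} {P Q : Fin m → Bool} {f g : Fin m → ℕ} →
             (∀ x → P x ≡ Q x) → (∀ x → f x ≡ g x) → sumOn P f ≡ sumOn Q g
sumOn-cong eP ef = sum-cong-≗ (λ x → cong₂ ind (eP x) (ef x))

sumOn-mono : ∀ {m} (P : Fin m → Bool) {f g : Fin m → ℕ} →
             (∀ x → P x ≡ true → f x ≤ g x) → sumOn P f ≤ sumOn P g
sumOn-mono P le = sum-mono (λ x → ind-mono (P x) (le x))

sumOn-mono-< : ∀ {m} (P : Fin m → Bool) {f g : Fin m → ℕ} → (∀ x → P x ≡ true → f x ≤ g x) →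
               ∀ t → P t ≡ true → f t < g t → sumOn P f < sumOn P g
sumOn-mono-< P le t Pt lt = sum-mono-< (λ x → ind-mono (P x) (le x)) t (weighted Pt lt)
  where
  weighted : ∀ {b x y} → b ≡ true → x < y → ind b x < ind b y
  weighted refl lt = lt

sumOn-⊆ : ∀ {m} {P Q : Fin m → Bool} → (∀ x → P x ≡ true → Q x ≡ true) →
          ∀ f → sumOn P f ≤ sumOn Q f
sumOn-⊆ P⊆Q f = sum-mono (λ x → ind-⊆ (P⊆Q x) (f x))

sumOn-∨ : ∀ {m} (P Q : Fin m → Bool) → (∀ x → P x ≡ true → Q x ≡ false) →
          ∀ f → sumOn (λ x → P x ∨ Q x) f ≡ sumOn P f + sumOn Q f
sumOn-∨ P Q disj f = trans (sum-cong-≗ (λ x → ind-∨ (P x) (Q x) (f x) (disj x)))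
                           (∑-distrib-+ (λ x → ind (P x) (f x)) (λ x → ind (Q x) (f x)))

sumOn-exchange-dep : ∀ {m k} (P : Fin m → Bool) (Q : Fin m → Fin k → Bool)
  (P' : Fin k → Bool) (Q' : Fin k → Fin m → Bool) (F : Fin m → Fin k → ℕ) →
  (∀ x t → P x ∧ Q x t ≡ P' t ∧ Q' t x) →
  sumOn P (λ x → sumOn (Q x) (F x)) ≡ sumOn P' (λ t → sumOn (Q' t) (λ x → F x t))
sumOn-exchange-dep {m} {k} P Q P' Q' F same = begin
  sum {m} (λ x → ind (P x) (sum {k} (λ t → ind (Q x t) (F x t))))
    ≡⟨ sum-cong-≗ {m} (λ x → ind-sum (P x) (λ t → ind (Q x t) (F x t))) ⟩
  sum {m} (λ x → sum {k} (λ t → ind (P x) (ind (Q x t) (F x t))))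
    ≡⟨ sum-cong-≗ {m} (λ x → sum-cong-≗ {k} (λ t → pair x t)) ⟩
  sum {m} (λ x → sum {k} (λ t → ind (P' t) (ind (Q' t x) (F x t))))
    ≡⟨ ∑-comm {m} {k} _ ⟩
  sum {k} (λ t → sum {m} (λ x → ind (P' t) (ind (Q' t x) (F x t))))
    ≡⟨ sum-cong-≗ {k} (λ t → sym (ind-sum (P' t) (λ x → ind (Q' t x) (F x t)))) ⟩
  sum {k} (λ t → ind (P' t) (sum {m} (λ x → ind (Q' t x) (F x t)))) ∎
  where
  open ≡-Reasoning
  pair : ∀ x t → ind (P x) (ind (Q x t) (F x t)) ≡ ind (P' t) (ind (Q' t x) (F x t))
  pair x t = trans (ind-∧ (P x) (Q x t) _) (trans (cong (λ b → ind b (F x t)) (same x t))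
                   (sym (ind-∧ (P' t) (Q' t x) _)))

sumOn-exchange : ∀ {m k} (P : Fin m → Bool) (Q : Fin k → Bool) (F : Fin m → Fin k → ℕ) →
  sumOn P (λ x → sumOn Q (F x)) ≡ sumOn Q (λ t → sumOn P (λ x → F x t))
sumOn-exchange P Q F = sumOn-exchange-dep P (λ _ → Q) Q (λ _ → P) F (λ x t → ∧-comm (P x) (Q t))

sumOn-term : ∀ {m} (P : Fin m → Bool) f x → P x ≡ true → f x ≤ sumOn P f
sumOn-term P f zero    Px rewrite Px = m≤m+n (f zero) _
sumOn-term P f (suc x) Px =
  ≤-trans (sumOn-term (λ y → P (suc y)) (λ y → f (suc y)) x Px) (m≤n+m _ _)

sumOn-pair : ∀ {m} (P : Fin m → Bool) f x y → x ≢ y → P x ≡ true → P y ≡ true →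
             f x + f y ≤ sumOn P f
sumOn-pair P f zero    zero    x≢y _ _ = ⊥-elim (x≢y refl)
sumOn-pair P f zero    (suc y) _ Px Py rewrite Px =
  +-monoʳ-≤ (f zero) (sumOn-term (λ z → P (suc z)) (λ z → f (suc z)) y Py)
sumOn-pair P f (suc x) zero    _ Px Py rewrite Py =
  subst (_≤ f zero + sumOn (λ z → P (suc z)) (λ z → f (suc z))) (+-comm (f zero) (f (suc x)))
        (+-monoʳ-≤ (f zero) (sumOn-term (λ z → P (suc z)) (λ z → f (suc z)) x Px))
sumOn-pair P f (suc x) (suc y) x≢y Px Py =
  ≤-trans (sumOn-pair (λ z → P (suc z)) (λ z → f (suc z)) x y (λ e → x≢y (cong suc e)) Px Py)
          (m≤n+m _ _)

sumOn-vanish : ∀ {m} (P : Fin m → Bool) f → (∀ x → P x ≡ true → f x ≡ 0) → sumOn P f ≡ 0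
sumOn-vanish {m} P f van = trans (sum-cong-≗ (λ x → ind0 (P x) (van x))) (sum-replicate-zero m)
  where
  ind0 : ∀ b {y} → (b ≡ true → y ≡ 0) → ind b y ≡ 0
  ind0 true  v = v refl
  ind0 false v = refl

sumOn-single : ∀ {m} (P : Fin m → Bool) f x → (∀ y → P y ≡ true → y ≡ x) → sumOn P f ≤ f x
sumOn-single P f zero only = begin
  ind (P zero) (f zero) + sumOn (λ y → P (suc y)) (λ y → f (suc y))
    ≡⟨ cong (ind (P zero) (f zero) +_) 
         (sumOn-vanish _ _ (λ y Py → ⊥-elim (Fin.0≢1+n (sym (only (suc y) Py))))) ⟩
  ind (P zero) (f zero) + 0
    ≡⟨ +-identityʳ _ ⟩
  ind (P zero) (f zero)
    ≤⟨ ind-≤ (P zero) (f zero) ⟩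
  f zero ∎
  where open ≤-Reasoning
sumOn-single P f (suc x) only rewrite false-if (λ P0 → Fin.0≢1+n (only zero P0)) =
  sumOn-single (λ y → P (suc y)) (λ y → f (suc y)) x (λ y Py → Fin.suc-injective (only (suc y) Py))

allF : ∀ {m} → (Fin m → Bool) → Bool
allF {zero}  p = true
allF {suc m} p = p zero ∧ allF (λ i → p (suc i))

anyF : ∀ {m} → (Fin m → Bool) → Bool
anyF {zero}  p = false
anyF {suc m} p = p zero ∨ anyF (λ i → p (suc i))

allF-elim : ∀ {m} (p : Fin m → Bool) → allF p ≡ true → ∀ i → p i ≡ true
allF-elim p e zero    = proj₁ (∧-elim e)
allF-elim p e (suc i) = allF-elim (λ j → p (suc j)) (proj₂ (∧-elim {p zero} e)) i

allF-intro : ∀ {m} (p : Fin m → Bool) → (∀ i → p i ≡ true) → allF p ≡ true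
allF-intro {zero}  p h = refl
allF-intro {suc m} p h = ∧-intro (h zero) (allF-intro (λ j → p (suc j)) (λ j → h (suc j)))

allF-witness : ∀ {m} (p : Fin m → Bool) → allF p ≡ false → ∃ λ i → p i ≡ false
allF-witness {suc m} p e with p zero in p0
... | false = zero , p0
... | true  = let (i , pi) = allF-witness (λ j → p (suc j)) e in suc i , pi

allF-cong : ∀ {m} {p q : Fin m → Bool} → (∀ i → p i ≡ q i) → allF p ≡ allF q
allF-cong {zero}  e = refl
allF-cong {suc m} e = cong₂ _∧_ (e zero) (allF-cong (λ i → e (suc i)))

anyF-intro : ∀ {m} (p : Fin m → Bool) i → p i ≡ true → anyF p ≡ true
anyF-intro p zero    e rewrite e = refl
anyF-intro p (suc i) e with p zero
... | true  = refl
... | false = anyF-intro (λ j → p (suc j)) i e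

anyF-elim : ∀ {m} (p : Fin m → Bool) → anyF p ≡ true → ∃ λ i → p i ≡ true
anyF-elim {suc m} p e with p zero in p0
... | true  = zero , p0
... | false = let (i , pi) = anyF-elim (λ j → p (suc j)) e in suc i , pi

infixl 5 _∖_
_∖_ : ∀ {n} → Subset n → Fin n → Subset n
U ∖ x = U [ x ]≔ false

⊤-∋ : ∀ {n} v → lookup (⊤ {n}) v ≡ true
⊤-∋ v = lookup-replicate v true

module _ {n : ℕ} (U : Subset n) where

  ∖-self : ∀ x → lookup (U ∖ x) x ≡ false
  ∖-self x = lookup∘updateAt x U

  ∖-other : ∀ {x y} → x ≢ y → lookup (U ∖ x) y ≡ lookup U y
  ∖-other {x} {y} x≢y = lookup∘updateAt′ y x (λ e → x≢y (sym e)) U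

  ∖-≢ : ∀ {x y} → lookup (U ∖ x) y ≡ true → x ≢ y
  ∖-≢ {x} in∖ refl = true≢false (trans (sym in∖) (∖-self x))

  ∖-⊆ : ∀ {x y} → lookup (U ∖ x) y ≡ true → lookup U y ≡ true
  ∖-⊆ in∖ = trans (sym (∖-other (∖-≢ in∖))) in∖

  ∖-keep : ∀ {x y} → x ≢ y → lookup U y ≡ true → lookup (U ∖ x) y ≡ true
  ∖-keep x≢y y∈U = trans (∖-other x≢y) y∈U

  ∖-comm : ∀ x y → U ∖ x ∖ y ≡ U ∖ y ∖ x
  ∖-comm x y with x ≟ y
  ... | yes refl = refl
  ... | no  x≢y  = []≔-commutes U x y x≢y

sumOn-∖-comm : ∀ {n} (F : Subset n → ℕ) (P : Fin n → Bool) U t →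
               sumOn P (λ x → F (U ∖ x ∖ t)) ≡ sumOn P (λ x → F (U ∖ t ∖ x))
sumOn-∖-comm F P U t = sumOn-cong (λ _ → refl) (λ x → cong F (∖-comm U x t))

noneIn : ∀ {n} → Subset n → (Fin n → Bool) → Bool
noneIn U p = allF (λ y → not (lookup U y ∧ p y))

module _ {n : ℕ} (U : Subset n) (p : Fin n → Bool) where

  noneIn-elim : noneIn U p ≡ true → ∀ y → lookup U y ≡ true → p y ≡ false
  noneIn-elim e y = notBoth (allF-elim _ e y)
    where
    notBoth : ∀ {a b} → not (a ∧ b) ≡ true → a ≡ true → b ≡ false
    notBoth {true} {false} _ refl = refl

  noneIn-intro : (∀ y → lookup U y ≡ true → p y ≡ false) → noneIn U p ≡ true
  noneIn-intro h = allF-intro _ (λ y → notBoth (h y))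
    where
    notBoth : ∀ {a b} → (a ≡ true → b ≡ false) → not (a ∧ b) ≡ true
    notBoth {false} f = refl
    notBoth {true}  f rewrite f refl = refl

  noneIn-witness : noneIn U p ≡ false → ∃ λ y → lookup U y ≡ true × p y ≡ true
  noneIn-witness e = let (y , q) = allF-witness _ e in y , ∧-elim (not-injective q)

noneIn-cong : ∀ {n} (U : Subset n) {p q : Fin n → Bool} → (∀ y → p y ≡ q y) → noneIn U p ≡ noneIn U q
noneIn-cong U e = allF-cong (λ y → cong (λ b → not (lookup U y ∧ b)) (e y))

isEmpty : ∀ {n} → Subset n → Bool
isEmpty U = noneIn U (λ _ → true)

isEmpty-elim : ∀ {n} (U : Subset n) → isEmpty U ≡ true → ∀ x → lookup U x ≡ false
isEmpty-elim U e x = false-if (λ x∈U → true≢false (noneIn-elim U _ e x x∈U))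

isEmpty-intro : ∀ {n} (U : Subset n) → (∀ x → lookup U x ≡ false) → isEmpty U ≡ true
isEmpty-intro U h = noneIn-intro U _ (λ x x∈U → ⊥-elim (true≢false (trans (sym x∈U) (h x))))

inhabited⇒nonEmpty : ∀ {n} (U : Subset n) {x} → lookup U x ≡ true → isEmpty U ≡ false
inhabited⇒nonEmpty U {x} x∈U = false-if (λ e → true≢false (trans (sym x∈U) (isEmpty-elim U e x)))

∣∖∣ : ∀ {n} (U : Subset n) x → lookup U x ≡ true → suc ∣ U ∖ x ∣ ≡ ∣ U ∣
∣∖∣ (true  ∷ U) zero    refl = refl
∣∖∣ (true  ∷ U) (suc x) x∈U  = cong suc (∣∖∣ U x x∈U)
∣∖∣ (false ∷ U) (suc x) x∈U  = ∣∖∣ U x x∈U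

member⇒∣∣>0 : ∀ {n} (U : Subset n) x → lookup U x ≡ true → 0 < ∣ U ∣
member⇒∣∣>0 U x x∈U = subst (0 <_) (∣∖∣ U x x∈U) (s≤s z≤n)

∣∣≡suc⇒inhabited : ∀ {n} (U : Subset n) {k} → ∣ U ∣ ≡ suc k → ∃ λ x → lookup U x ≡ true
∣∣≡suc⇒inhabited (true  ∷ U) e = zero , refl
∣∣≡suc⇒inhabited (false ∷ U) e = let (x , x∈U) = ∣∣≡suc⇒inhabited U e in suc x , x∈U

module _ {n : ℕ} where

  minimalIn : DiRel n → Subset n → Fin n → Bool
  minimalIn O U s = lookup U s ∧ noneIn U (λ y → O y s)

  maximalIn : DiRel n → Subset n → Fin n → Bool
  maximalIn O = minimalIn (flip O)

  Irreflexive : DiRel n → Set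
  Irreflexive O = ∀ x → O x x ≡ false

  minimal-elim : ∀ O U s → minimalIn O U s ≡ true →
                 lookup U s ≡ true × (∀ y → lookup U y ≡ true → O y s ≡ false)
  minimal-elim O U s e = let (s∈U , noPred) = ∧-elim e in s∈U , noneIn-elim U _ noPred

  minimal-intro : ∀ O U s → lookup U s ≡ true → (∀ y → lookup U y ≡ true → O y s ≡ false) →
                  minimalIn O U s ≡ true
  minimal-intro O U s s∈U noPred = ∧-intro s∈U (noneIn-intro U _ noPred)

  minimal-cong : ∀ {O O'} → O ≐ O' → ∀ U s → minimalIn O U s ≡ minimalIn O' U s
  minimal-cong O≐O' U s = cong (lookup U s ∧_) (noneIn-cong U (λ y → O≐O' y s))

  -- extCount O k U counts the listings of U in k steps in which every
  -- element appears after all of its O-predecessors lying in U: a listing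
  -- starts with a minimal element s and continues with a listing of U ∖ s.
  extCount : DiRel n → ℕ → Subset n → ℕ
  extCount O zero    U = ind (isEmpty U) 1
  extCount O (suc k) U = sumOn (minimalIn O U) (λ s → extCount O k (U ∖ s))

  extCount-cong : ∀ {O O'} → O ≐ O' → ∀ k U → extCount O k U ≡ extCount O' k U
  extCount-cong O≐O' zero    U = refl
  extCount-cong O≐O' (suc k) U =
    sumOn-cong (minimal-cong O≐O' U) (λ s → extCount-cong O≐O' k (U ∖ s))

  minimal-∖ : ∀ O U s t → s ≢ t → minimalIn O U s ≡ true → minimalIn O (U ∖ t) s ≡ true
  minimal-∖ O U s t s≢t min =
    let (s∈U , noPred) = minimal-elim O U s min
    in minimal-intro O (U ∖ t) s (∖-keep U (λ e → s≢t (sym e)) s∈U)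
                     (λ y y∈U∖t → noPred y (∖-⊆ U y∈U∖t))

  -- If s is minimal in U and t is maximal in U ∖ s, then t is maximal in U
  -- and s is minimal in U ∖ t: the first and the last step commute.
  first-last-swap : ∀ O U s t → minimalIn O U s ∧ maximalIn O (U ∖ s) t ≡ true →
                    maximalIn O U t ∧ minimalIn O (U ∖ t) s ≡ true
  first-last-swap O U s t e =
    ∧-intro (minimal-intro (flip O) U t (∖-⊆ U t∈U∖s) noSucc)
            (minimal-∖ O U s t (∖-≢ U t∈U∖s) min-s)
    where
    min-s : minimalIn O U s ≡ true
    min-s = proj₁ (∧-elim {minimalIn O U s} e)
    max-t : maximalIn O (U ∖ s) t ≡ true
    max-t = proj₂ (∧-elim {minimalIn O U s} e)
    t∈U∖s : lookup (U ∖ s) t ≡ true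
    t∈U∖s = proj₁ (minimal-elim (flip O) (U ∖ s) t max-t)
    noSucc : ∀ y → lookup U y ≡ true → O t y ≡ false
    noSucc y y∈U with s ≟ y
    ... | yes refl = proj₂ (minimal-elim O U s min-s) t (∖-⊆ U t∈U∖s)
    ... | no  s≢y  = proj₂ (minimal-elim (flip O) (U ∖ s) t max-t) y (∖-keep U s≢y y∈U)

  alone⇒minimal : ∀ O → Irreflexive O → ∀ U s → isEmpty (U ∖ s) ≡ true →
                  minimalIn O U s ≡ lookup U s
  alone⇒minimal O irr U s empty with lookup U s in s∈U
  ... | false = refl
  ... | true  = proj₂ (∧-elim (minimal-intro O U s s∈U noPred))
    where
    noPred : ∀ y → lookup U y ≡ true → O y s ≡ false
    noPred y y∈U with s ≟ y
    ... | yes refl = irr s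
    ... | no  s≢y  = ⊥-elim (true≢false (trans (sym (∖-keep U s≢y y∈U)) (isEmpty-elim (U ∖ s) empty y)))

  extCount-by-maximal : ∀ O → Irreflexive O → ∀ k U →
    extCount O (suc k) U ≡ sumOn (maximalIn O U) (λ t → extCount O k (U ∖ t))
  extCount-by-maximal O irr zero    U = sum-cong-≗ (λ s →
    trans (ind-∧ (minimalIn O U s) _ 1) (trans (cong (λ b → ind b 1) (same-pred s))
          (sym (ind-∧ (maximalIn O U s) _ 1))))
    where
    same-pred : ∀ s → minimalIn O U s ∧ isEmpty (U ∖ s) ≡ maximalIn O U s ∧ isEmpty (U ∖ s)
    same-pred s with isEmpty (U ∖ s) in empty
    ... | false = trans (∧-zeroʳ _) (sym (∧-zeroʳ _))
    ... | true  = cong (_∧ true) (trans (alone⇒minimal O irr U s empty)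
                                        (sym (alone⇒minimal (flip O) irr U s empty)))
  extCount-by-maximal O irr (suc k) U = begin
    sumOn (minimalIn O U) (λ s → extCount O (suc k) (U ∖ s))
      ≡⟨ sumOn-cong (λ _ → refl) (λ s → extCount-by-maximal O irr k (U ∖ s)) ⟩
    sumOn (minimalIn O U) (λ s → sumOn (maximalIn O (U ∖ s)) (λ t → extCount O k (U ∖ s ∖ t)))
      ≡⟨ sumOn-exchange-dep _ _ _ _ _ (λ s t → ⇔→≡ (mk⇔ (first-last-swap O U s t)
                                                         (first-last-swap (flip O) U t s))) ⟩
    sumOn (maximalIn O U) (λ t → sumOn (minimalIn O (U ∖ t)) (λ s → extCount O k (U ∖ s ∖ t)))
      ≡⟨ sumOn-cong (λ _ → refl) (λ t → sumOn-∖-comm (extCount O k) (minimalIn O (U ∖ t)) U t) ⟩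
    sumOn (maximalIn O U) (λ t → extCount O (suc k) (U ∖ t)) ∎
    where open ≡-Reasoning

module Bipartite {n : ℕ} (G : SimpleGraph n) (col : Fin n → Bool) (bip : IsBipartition G col) where

  A : Fin n → Fin n → Bool
  A = adj G

  up down : DiRel n
  up   = Oup G col
  down = Odown G col

  col-adj : ∀ {u v} → A u v ≡ true → col v ≡ not (col u)
  col-adj {u} {v} e = ¬-not (λ q → bip u v e (sym q))

  adj-≢ : ∀ {u v} → A u v ≡ true → u ≢ v
  adj-≢ {u} e refl = true≢false (trans (sym e) (irrefl G u))

  adj-comm : ∀ {u v} → A u v ≡ true → A v u ≡ true
  adj-comm {u} {v} e = trans (SimpleGraph.sym G v u) e

  onSide : Bool → Fin n → Bool
  onSide true  x = col x
  onSide false x = not (col x)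

  onSide-not : ∀ c x → onSide (not c) x ≡ not (onSide c x)
  onSide-not true  x = refl
  onSide-not false x = sym (not-involutive (col x))

  onSide-col : ∀ x → onSide (col x) x ≡ true
  onSide-col x with col x in e
  ... | true  = e
  ... | false = cong not e

  onSide-flip : ∀ {c x} → onSide c x ≡ false → onSide (not c) x ≡ true
  onSide-flip {c} {x} e = trans (onSide-not c x) (cong not e)

  onSide-unflip : ∀ {c x} → onSide (not c) x ≡ true → onSide c x ≡ false
  onSide-unflip {c} {x} e = not-injective (trans (sym (onSide-not c x)) e)

  distance-two : ∀ {u v w} → A u v ≡ true → A v w ≡ true → col w ≡ col u
  distance-two {u} uv vw = trans (col-adj vw) (trans (cong not (col-adj uv)) (not-involutive (col u)))

  onSide-adj : ∀ c {u v} → A u v ≡ true → onSide c v ≡ not (onSide c u)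
  onSide-adj true  e = col-adj e
  onSide-adj false e = cong not (col-adj e)

  isolatedIn : Subset n → Fin n → Bool
  isolatedIn U x = noneIn U (A x)

  adj⇒not-isolated : ∀ U {x y} → lookup U y ≡ true → A x y ≡ true → isolatedIn U x ≡ false
  adj⇒not-isolated U {x} {y} y∈U a =
    false-if (λ iso → true≢false (trans (sym a) (noneIn-elim U (A x) iso y y∈U)))

  isolated-∖ : ∀ U x t → isolatedIn U x ≡ true → isolatedIn (U ∖ t) x ≡ true
  isolated-∖ U x t iso =
    noneIn-intro (U ∖ t) (A x) (λ y y∈U∖t → noneIn-elim U (A x) iso y (∖-⊆ U y∈U∖t))

  -- removable c U x: x ∈ U lies on side c or is isolated in U.  These are the
  -- vertices that Oup lets go first (c = false) or last (c = true).
  removable : Bool → Subset n → Fin n → Bool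
  removable c U x = lookup U x ∧ (onSide c x ∨ isolatedIn U x)

  minimal-uniform : ∀ O U x c → (∀ y → O y x ≡ A x y ∧ c) →
                    minimalIn O U x ≡ lookup U x ∧ (not c ∨ isolatedIn U x)
  minimal-uniform O U x true  pred =
    cong (lookup U x ∧_) (noneIn-cong U (λ y → trans (pred y) (∧-identityʳ (A x y))))
  minimal-uniform O U x false pred =
    cong (lookup U x ∧_) (noneIn-intro U _ (λ y _ → trans (pred y) (∧-zeroʳ (A x y))))

  up-pred : ∀ y x → up y x ≡ A x y ∧ col x
  up-pred y x rewrite SimpleGraph.sym G x y with A y x in e
  ... | false = refl
  ... | true rewrite col-adj e with col y
  ...   | true  = refl
  ...   | false = refl

  up-succ : ∀ x y → up x y ≡ A x y ∧ not (col x)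
  up-succ x y with A x y in e
  ... | false = refl
  ... | true rewrite col-adj e with col x
  ...   | true  = refl
  ...   | false = refl

  down-pred : ∀ y x → down y x ≡ A x y ∧ not (col x)
  down-pred y x rewrite SimpleGraph.sym G x y with A y x in e
  ... | false = refl
  ... | true rewrite col-adj e with col y
  ...   | true  = refl
  ...   | false = refl

  down-succ : ∀ x y → down x y ≡ A x y ∧ col x
  down-succ x y with A x y in e
  ... | false = refl
  ... | true rewrite col-adj e with col x
  ...   | true  = refl
  ...   | false = refl

  up-irreflexive : Irreflexive up
  up-irreflexive x rewrite irrefl G x = refl

  minimal-up : ∀ U x → minimalIn up U x ≡ removable false U x
  minimal-up U x = minimal-uniform up U x (col x) (λ y → up-pred y x)

  maximal-up : ∀ U x → maximalIn up U x ≡ removable true U x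
  maximal-up U x = trans (minimal-uniform (flip up) U x (not (col x)) (λ y → up-succ x y))
                         (cong (λ b → lookup U x ∧ (b ∨ isolatedIn U x)) (not-involutive (col x)))

  minimal-down : ∀ U x → minimalIn down U x ≡ removable true U x
  minimal-down U x = trans (minimal-uniform down U x (not (col x)) (λ y → down-pred y x))
                           (cong (λ b → lookup U x ∧ (b ∨ isolatedIn U x)) (not-involutive (col x)))

  h : ℕ → Subset n → ℕ
  h = extCount up

  up-recurrence : ∀ c k U → h (suc k) U ≡ sumOn (removable c U) (λ x → h k (U ∖ x))
  up-recurrence false k U = sumOn-cong (minimal-up U) (λ _ → refl)
  up-recurrence true  k U =
    trans (extCount-by-maximal up up-irreflexive k U) (sumOn-cong (maximal-up U) (λ _ → refl))

  -- Odown is Oup reversed, so it has as many linear extensions.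
  extCount-down : ∀ k U → extCount down k U ≡ h k U
  extCount-down zero    U = refl
  extCount-down (suc k) U =
    trans (sumOn-cong (minimal-down U) (λ x → extCount-down k (U ∖ x))) (sym (up-recurrence true k U))

  removable-elim : ∀ c U {x} → removable c U x ≡ true →
                   lookup U x ≡ true × (onSide c x ≡ true ⊎ isolatedIn U x ≡ true)
  removable-elim c U e = let (x∈U , r) = ∧-elim e in x∈U , ∨-elim r

  not-removable-elim : ∀ c U {x} → lookup U x ≡ true → removable c U x ≡ false →
                       onSide c x ≡ false × isolatedIn U x ≡ false
  not-removable-elim c U {x} x∈U e rewrite x∈U = ∨-conicalˡ _ _ e , ∨-conicalʳ _ _ e

  nbrs : Subset n → (Fin n → Bool) → Fin n → Bool
  nbrs U S t = lookup U t ∧ anyF (λ s → S s ∧ A s t)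

  nbrs-elim : ∀ U S {t} → nbrs U S t ≡ true →
              lookup U t ≡ true × ∃ λ s → S s ≡ true × A s t ≡ true
  nbrs-elim U S e = let (t∈U , some) = ∧-elim e ; (s , q) = anyF-elim _ some in t∈U , s , ∧-elim q

  nbrs-intro : ∀ U S {s t} → lookup U t ≡ true → S s ≡ true → A s t ≡ true → nbrs U S t ≡ true
  nbrs-intro U S {s} t∈U Ss a = ∧-intro t∈U (anyF-intro _ s (∧-intro Ss a))

  Attached : Bool → Subset n → (Fin n → Bool) → Set
  Attached c U S = ∀ s → S s ≡ true → lookup U s ≡ true × onSide c s ≡ true × isolatedIn U s ≡ false

  outside : Bool → Subset n → (Fin n → Bool) → Fin n → Bool
  outside c U T x = (lookup U x ∧ not (isolatedIn U x)) ∧ (onSide c x ∧ not (T x))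

  outside-elim : ∀ c U T {x} → outside c U T x ≡ true →
    (lookup U x ≡ true × onSide c x ≡ true × isolatedIn U x ≡ false) × T x ≡ false
  outside-elim c U T e =
    let (a , b) = ∧-elim e ; (x∈U , niso) = ∧-not-elim a ; (side , notT) = ∧-not-elim b
    in (x∈U , side , niso) , notT

  outside-intro : ∀ c U T {x} → lookup U x ≡ true → onSide c x ≡ true → isolatedIn U x ≡ false →
                  T x ≡ false → outside c U T x ≡ true
  outside-intro c U T x∈U side niso notT = ∧-intro (∧-not-intro x∈U niso) (∧-not-intro side notT)

  attached⇒h0 : ∀ U s → isolatedIn U s ≡ false → h 0 (U ∖ s) ≡ 0
  attached⇒h0 U s niso =
    let (y , y∈U , a) = noneIn-witness U (A s) niso
    in cong (λ b → ind b 1) (inhabited⇒nonEmpty (U ∖ s) (∖-keep U (adj-≢ a) y∈U))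

  NeighbourhoodBound : ℕ → Set
  NeighbourhoodBound k = ∀ c U S → Attached c U S →
    sumOn S (λ s → h k (U ∖ s)) ≤ sumOn (nbrs U S) (λ t → h k (U ∖ t))

  -- With no steps left, removing an attached vertex leaves a nonempty set,
  -- which has no listing.
  neighbourhood-base : NeighbourhoodBound 0
  neighbourhood-base c U S att =
    ≤-trans (≤-reflexive (sumOn-vanish S _ (λ s Ss → attached⇒h0 U s (proj₂ (proj₂ (att s Ss)))))) z≤n

  module NeighbourhoodStep (k : ℕ) (IH : NeighbourhoodBound k)
                           (c : Bool) (U : Subset n) (S : Fin n → Bool) (att : Attached c U S) where

    N : Fin n → Bool
    N = nbrs U S

    φ : Fin n → ℕ
    φ x = sumOn N (λ t → h k (U ∖ x ∖ t))

    N-elim : ∀ {t} → N t ≡ true → lookup U t ≡ true × onSide c t ≡ false × isolatedIn U t ≡ false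
    N-elim Nt =
      let (t∈U , s , Ss , a) = nbrs-elim U S Nt ; (s∈U , side , _) = att s Ss
      in t∈U , trans (onSide-adj c a) (cong not side) , adj⇒not-isolated U s∈U (adj-comm a)

    c' : Bool
    c' = not c

    S-not-removable : ∀ {s} → S s ≡ true → removable c' U s ≡ false
    S-not-removable {s} Ss =
      let (_ , side , niso) = att s Ss
      in trans (cong (lookup U s ∧_) (cong₂ _∨_ (trans (onSide-not c s) (cong not side)) niso))
               (∧-zeroʳ (lookup U s))

    L : Fin n → ℕ
    L x = sumOn (λ s → S s ∧ removable c' (U ∖ s) x) (λ s → h k (U ∖ s ∖ x))

    lhs-expand : sumOn S (λ s → h (suc k) (U ∖ s)) ≡ sum L
    lhs-expand =
      trans (sumOn-cong (λ _ → refl) (λ s → up-recurrence c' k (U ∖ s)))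
            (sumOn-exchange-dep S (λ s → removable c' (U ∖ s)) (λ _ → true)
                                (λ x s → S s ∧ removable c' (U ∖ s) x) _ (λ _ _ → refl))

    ψ : Fin n → ℕ
    ψ x = sumOn S (λ s → h k (U ∖ s ∖ x))

    R : Fin n → Bool
    R x = removable c' U x ∧ not (N x)

    -- Away from N, removing x keeps S attached and its neighbourhood.
    ψ≤φ : ∀ x → removable c' U x ≡ true → N x ≡ false → ψ x ≤ φ x
    ψ≤φ x rem-x notN = begin
      sumOn S (λ s → h k (U ∖ s ∖ x)) ≡⟨ sumOn-∖-comm (h k) S U x ⟩
      sumOn S (λ s → h k (U ∖ x ∖ s)) ≤⟨ IH c (U ∖ x) S att' ⟩
      sumOn (nbrs (U ∖ x) S) (λ t → h k (U ∖ x ∖ t)) ≡⟨ sumOn-cong same-nbrs (λ _ → refl) ⟩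
      φ x ∎
      where
      open ≤-Reasoning
      att' : Attached c (U ∖ x) S
      att' s Ss =
        let (s∈U , side , niso) = att s Ss
            (y , y∈U , a) = noneIn-witness U (A s) niso
            x≢s : x ≢ s
            x≢s = λ { refl → true≢false (trans (sym rem-x) (S-not-removable Ss)) }
            x≢y : x ≢ y
            x≢y = λ { refl → true≢false (trans (sym (nbrs-intro U S y∈U Ss a)) notN) }
        in ∖-keep U x≢s s∈U , side , adj⇒not-isolated (U ∖ x) (∖-keep U x≢y y∈U) a
      same-nbrs : ∀ t → nbrs (U ∖ x) S t ≡ N t
      same-nbrs t with x ≟ t
      ... | yes refl = trans (cong (_∧ _) (∖-self U x)) (sym notN)
      ... | no  x≢t  = cong (_∧ _) (∖-other U x≢t)

    L-vanishes : ∀ x → N x ≡ false → R x ≡ false → L x ≡ 0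
    L-vanishes x notN notR = sumOn-vanish _ _ (λ s e → ⊥-elim (impossible s (∧-elim e)))
      where
      not-rem : removable c' U x ≡ false
      not-rem = false-if (λ r → true≢false (trans (sym (∧-not-intro r notN)) notR))
      impossible : ∀ s → S s ≡ true × removable c' (U ∖ s) x ≡ true → ⊥
      impossible s (Ss , rem) = case (proj₂ (removable-elim c' (U ∖ s) rem))
        where
        -- x lies on side c and has a neighbour in U …
        stuck : onSide c' x ≡ false × isolatedIn U x ≡ false
        stuck = not-removable-elim c' U (∖-⊆ U (proj₁ (removable-elim c' (U ∖ s) rem))) not-rem
        -- … which is not s, as s lies on side c too.
        s≢nbr : ∀ {y} → A x y ≡ true → s ≢ y
        s≢nbr a refl = true≢false (trans (sym (proj₁ (proj₂ (att s Ss))))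
          (trans (onSide-adj c a) (cong not (not-injective (trans (sym (onSide-not c x)) (proj₁ stuck))))))
        case : onSide c' x ≡ true ⊎ isolatedIn (U ∖ s) x ≡ true → ⊥
        case (inj₁ side') = true≢false (trans (sym side') (proj₁ stuck))
        case (inj₂ iso∖s) =
          let (y , y∈U , a) = noneIn-witness U (A x) (proj₂ stuck)
          in true≢false (trans (sym a) (noneIn-elim (U ∖ s) (A x) iso∖s y (∖-keep U (s≢nbr a) y∈U)))

    L-bound : ∀ x → L x ≤ ind (N x) (ψ x) + ind (R x) (φ x)
    L-bound x = ind-cases (N x) (R x) L≤ψ
      (λ notN inR → ≤-trans L≤ψ (ψ≤φ x (proj₁ (∧-elim inR)) notN)) (L-vanishes x)
      where
      L≤ψ : L x ≤ ψ x
      L≤ψ = sumOn-⊆ (λ s e → proj₁ (∧-elim e)) (λ s → h k (U ∖ s ∖ x))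

    -- Right-hand side: every vertex removable from U on side c stays
    -- removable after removing a neighbour of S.
    rhs-bound : sumOn (removable c U) φ ≤ sumOn N (λ t → h (suc k) (U ∖ t))
    rhs-bound = begin
      sumOn (removable c U) φ
        ≡⟨ sumOn-exchange (removable c U) N (λ x t → h k (U ∖ x ∖ t)) ⟩
      sumOn N (λ t → sumOn (removable c U) (λ x → h k (U ∖ x ∖ t)))
        ≤⟨ sumOn-mono N (λ t Nt → ≤-trans (≤-reflexive (sumOn-∖-comm (h k) (removable c U) U t))
                                           (sumOn-⊆ (stays-removable Nt) (λ x → h k (U ∖ t ∖ x)))) ⟩
      sumOn N (λ t → sumOn (removable c (U ∖ t)) (λ x → h k (U ∖ t ∖ x)))
        ≡⟨ sumOn-cong (λ _ → refl) (λ t → sym (up-recurrence c k (U ∖ t))) ⟩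
      sumOn N (λ t → h (suc k) (U ∖ t)) ∎
      where
      open ≤-Reasoning
      stays-removable : ∀ {t} → N t ≡ true → ∀ x →
                        removable c U x ≡ true → removable c (U ∖ t) x ≡ true
      stays-removable {t} Nt x rem with removable-elim c U rem
      ... | x∈U , inj₁ side = ∧-intro (∖-keep U t≢x x∈U) (∨-introˡ _ side)
        where t≢x = λ { refl → true≢false (trans (sym side) (proj₁ (proj₂ (N-elim Nt)))) }
      ... | x∈U , inj₂ iso  = ∧-intro (∖-keep U t≢x x∈U) (∨-introʳ _ (isolated-∖ U x t iso))
        where t≢x = λ { refl → true≢false (trans (sym iso) (proj₂ (proj₂ (N-elim Nt)))) }

    -- The vertices of U outside N ∪ S fall into three kinds: the isolated
    -- ones Z, the attached ones of side c' (Y) and those of side c (X).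
    Z Y X : Fin n → Bool
    Z x = lookup U x ∧ isolatedIn U x
    Y = outside c' U N
    X = outside c U S

    Z-not-outside : ∀ c'' T {x} → Z x ≡ true → outside c'' U T x ≡ false
    Z-not-outside c'' T {x} Zx = false-if (λ o →
      true≢false (trans (sym (proj₂ (∧-elim Zx))) (proj₂ (proj₂ (proj₁ (outside-elim c'' U T o))))))

    Z-or-attached : ∀ {x} → lookup U x ≡ true → Z x ≡ true ⊎ isolatedIn U x ≡ false
    Z-or-attached {x} x∈U with isolatedIn U x
    ... | true  = inj₁ (∧-intro x∈U refl)
    ... | false = inj₂ refl

    R⊆Z∨Y : ∀ x → R x ≡ true → Z x ∨ Y x ≡ true
    R⊆Z∨Y x Rx with ∧-not-elim Rx
    ... | rem , notN with removable-elim c' U rem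
    ...   | x∈U , inj₂ iso  = ∨-introˡ _ (∧-intro x∈U iso)
    ...   | x∈U , inj₁ side with Z-or-attached x∈U
    ...     | inj₁ Zx   = ∨-introˡ _ Zx
    ...     | inj₂ niso = ∨-introʳ _ (outside-intro c' U N x∈U side niso notN)

    -- Y weighs at most as much as X: after removing t ∈ N, the induction
    -- hypothesis trades Y for its neighbours, which lie in X.
    Y≤X : sumOn Y φ ≤ sumOn X φ
    Y≤X = begin
      sumOn Y φ
        ≡⟨ sumOn-exchange Y N (λ x t → h k (U ∖ x ∖ t)) ⟩
      sumOn N (λ t → sumOn Y (λ x → h k (U ∖ x ∖ t)))
        ≤⟨ sumOn-mono N through ⟩
      sumOn N (λ t → sumOn X (λ x → h k (U ∖ x ∖ t)))
        ≡⟨ sumOn-exchange X N (λ x t → h k (U ∖ x ∖ t)) ⟨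
      sumOn X φ ∎
      where
      open ≤-Reasoning
      attY : ∀ {t} → N t ≡ true → Attached c' (U ∖ t) Y
      attY {t} Nt x Yx =
        let ((x∈U , side' , niso) , notN) = outside-elim c' U N Yx
            (y , y∈U , a) = noneIn-witness U (A x) niso
            t≢x : t ≢ x
            t≢x = λ { refl → true≢false (trans (sym Nt) notN) }
            t≢y : t ≢ y
            t≢y = λ { refl → true≢false (trans (sym (onSide-flip {c} {t} (proj₁ (proj₂ (N-elim Nt)))))
                                               (trans (onSide-adj c' a) (cong not side'))) }
        in ∖-keep U t≢x x∈U , side' , adj⇒not-isolated (U ∖ t) (∖-keep U t≢y y∈U) a
      nbrs⊆X : ∀ t y → nbrs (U ∖ t) Y y ≡ true → X y ≡ true
      nbrs⊆X t y e =
        let (y∈U∖t , x , Yx , a) = nbrs-elim (U ∖ t) Y e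
            ((x∈U , side' , _) , notN) = outside-elim c' U N Yx
            notS : S y ≡ false
            notS = false-if (λ Sy → true≢false (trans (sym (nbrs-intro U S x∈U Sy (adj-comm a))) notN))
        in outside-intro c U S (∖-⊆ U y∈U∖t) (trans (onSide-adj c a) (cong not (onSide-unflip {c} {x} side')))
                         (adj⇒not-isolated U x∈U (adj-comm a)) notS
      through : ∀ t → N t ≡ true →
                sumOn Y (λ x → h k (U ∖ x ∖ t)) ≤ sumOn X (λ x → h k (U ∖ x ∖ t))
      through t Nt = begin
        sumOn Y (λ x → h k (U ∖ x ∖ t)) ≡⟨ sumOn-∖-comm (h k) Y U t ⟩
        sumOn Y (λ x → h k (U ∖ t ∖ x)) ≤⟨ IH c' (U ∖ t) Y (attY Nt) ⟩
        sumOn (nbrs (U ∖ t) Y) (λ x → h k (U ∖ t ∖ x)) ≤⟨ sumOn-⊆ (nbrs⊆X t) (λ x → h k (U ∖ t ∖ x)) ⟩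
        sumOn X (λ x → h k (U ∖ t ∖ x)) ≡⟨ sumOn-∖-comm (h k) X U t ⟨
        sumOn X (λ x → h k (U ∖ x ∖ t)) ∎

    -- R is covered by Z and Y; trading Y for X, the disjoint sets S, Z, X
    -- together make up vertices removable on side c.
    middle : sumOn S φ + sumOn R φ ≤ sumOn (removable c U) φ
    middle = begin
      sumOn S φ + sumOn R φ
        ≤⟨ +-monoʳ-≤ (sumOn S φ) (sumOn-⊆ R⊆Z∨Y φ) ⟩
      sumOn S φ + sumOn (λ x → Z x ∨ Y x) φ
        ≡⟨ cong (sumOn S φ +_) (sumOn-∨ Z Y (λ x → Z-not-outside c' N) φ) ⟩
      sumOn S φ + (sumOn Z φ + sumOn Y φ)
        ≤⟨ +-monoʳ-≤ (sumOn S φ) (+-monoʳ-≤ (sumOn Z φ) Y≤X) ⟩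
      sumOn S φ + (sumOn Z φ + sumOn X φ)
        ≡⟨ cong (sumOn S φ +_) (sumOn-∨ Z X (λ x → Z-not-outside c S) φ) ⟨
      sumOn S φ + sumOn (λ x → Z x ∨ X x) φ
        ≡⟨ sumOn-∨ S (λ x → Z x ∨ X x) S-apart φ ⟨
      sumOn (λ x → S x ∨ (Z x ∨ X x)) φ
        ≤⟨ sumOn-⊆ covered φ ⟩
      sumOn (removable c U) φ ∎
      where
      open ≤-Reasoning
      S-apart : ∀ x → S x ≡ true → Z x ∨ X x ≡ false
      S-apart x Sx = cong₂ _∨_ (trans (cong (lookup U x ∧_) (proj₂ (proj₂ (att x Sx)))) (∧-zeroʳ _))
                               (false-if (λ o → true≢false (trans (sym Sx) (proj₂ (outside-elim c U S o)))))
      covered : ∀ x → S x ∨ (Z x ∨ X x) ≡ true → removable c U x ≡ true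
      covered x e with ∨-elim e
      ... | inj₁ Sx = let (x∈U , side , _) = att x Sx in ∧-intro x∈U (∨-introˡ _ side)
      ... | inj₂ o with ∨-elim o
      ...   | inj₁ Zx = let (x∈U , iso) = ∧-elim {lookup U x} Zx in ∧-intro x∈U (∨-introʳ _ iso)
      ...   | inj₂ Xx = let ((x∈U , side , _) , _) = outside-elim c U S Xx in ∧-intro x∈U (∨-introˡ _ side)

    -- Summing the term bounds, the N-part equals the S-part of φ by exchange.
    bound : sumOn S (λ s → h (suc k) (U ∖ s)) ≤ sumOn N (λ t → h (suc k) (U ∖ t))
    bound = begin
      sumOn S (λ s → h (suc k) (U ∖ s))
        ≡⟨ lhs-expand ⟩
      sum L
        ≤⟨ sum-mono L-bound ⟩
      sum (λ x → ind (N x) (ψ x) + ind (R x) (φ x))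
        ≡⟨ ∑-distrib-+ {n} (λ x → ind (N x) (ψ x)) (λ x → ind (R x) (φ x)) ⟩
      sumOn N ψ + sumOn R φ
        ≡⟨ cong (_+ sumOn R φ) (sumOn-exchange N S (λ x s → h k (U ∖ s ∖ x))) ⟩
      sumOn S φ + sumOn R φ
        ≤⟨ middle ⟩
      sumOn (removable c U) φ
        ≤⟨ rhs-bound ⟩
      sumOn N (λ t → h (suc k) (U ∖ t)) ∎
      where open ≤-Reasoning

  neighbourhood-bound : ∀ k → NeighbourhoodBound k
  neighbourhood-bound zero    = neighbourhood-base
  neighbourhood-bound (suc k) c U S att = NeighbourhoodStep.bound k (neighbourhood-bound k) c U S att

  -- The members of I
  -- of colour false with a neighbour in U are traded for their neighbours.
  independent-bound : ∀ k U I → (∀ x → I x ≡ true → lookup U x ≡ true) →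
    (∀ x y → I x ≡ true → I y ≡ true → A x y ≡ false) →
    sumOn I (λ x → h k (U ∖ x)) ≤ h (suc k) U
  independent-bound k U I I⊆U indep = begin
    sumOn I g                            ≤⟨ sumOn-⊆ (λ x Ix → split (I x) (removable true U x) Ix) g ⟩
    sumOn (λ x → Ia x ∨ Ir x) g          ≡⟨ sumOn-∨ Ia Ir Ia-apart g ⟩
    sumOn Ia g + sumOn Ir g              ≤⟨ +-monoˡ-≤ (sumOn Ir g) (neighbourhood-bound k false U Ia att) ⟩
    sumOn (nbrs U Ia) g + sumOn Ir g     ≡⟨ sumOn-∨ (nbrs U Ia) Ir nbrs-apart g ⟨
    sumOn (λ x → nbrs U Ia x ∨ Ir x) g   ≤⟨ sumOn-⊆ covered g ⟩
    sumOn (removable true U) g           ≡⟨ up-recurrence true k U ⟨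
    h (suc k) U                          ∎
    where
    open ≤-Reasoning
    g : Fin n → ℕ
    g x = h k (U ∖ x)
    Ia Ir : Fin n → Bool
    Ia x = I x ∧ not (removable true U x)
    Ir x = I x ∧ removable true U x
    split : ∀ a b → a ≡ true → (a ∧ not b) ∨ (a ∧ b) ≡ true
    split true false _ = refl
    split true true  _ = refl
    Ia-elim : ∀ {x} → Ia x ≡ true → I x ≡ true × onSide true x ≡ false × isolatedIn U x ≡ false
    Ia-elim {x} e = let (Ix , notRem) = ∧-not-elim e in Ix , not-removable-elim true U (I⊆U x Ix) notRem
    att : Attached false U Ia
    att x e = let (Ix , side , niso) = Ia-elim e in I⊆U x Ix , onSide-flip {true} {x} side , niso
    Ia-apart : ∀ x → Ia x ≡ true → Ir x ≡ false
    Ia-apart x e =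
      false-if (λ r → true≢false (trans (sym (proj₂ (∧-elim {I x} r))) (proj₂ (∧-not-elim e))))
    nbrs-apart : ∀ x → nbrs U Ia x ≡ true → Ir x ≡ false
    nbrs-apart x e = let (_ , s , Ias , a) = nbrs-elim U Ia e in
      false-if (λ r → true≢false
        (trans (sym a) (indep s x (proj₁ (Ia-elim Ias)) (proj₁ (∧-elim {I x} r)))))
    covered : ∀ x → nbrs U Ia x ∨ Ir x ≡ true → removable true U x ≡ true
    covered x e with ∨-elim e
    ... | inj₁ nb = let (x∈U , s , Ias , a) = nbrs-elim U Ia nb in
      ∧-intro x∈U (∨-introˡ _ (trans (onSide-adj true a) (cong not (proj₁ (proj₂ (Ia-elim Ias))))))
    ... | inj₂ r = proj₂ (∧-elim {I x} r)

  removable-exists : ∀ c U {x} → lookup U x ≡ true → ∃ λ y → removable c U y ≡ true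
  removable-exists c U {x} x∈U with onSide c x in side | isolatedIn U x in iso
  ... | true  | _     = x , ∧-intro x∈U (∨-introˡ _ side)
  ... | false | true  = x , ∧-intro x∈U (∨-introʳ _ iso)
  ... | false | false =
    let (y , y∈U , a) = noneIn-witness U (A x) iso
    in y , ∧-intro y∈U (∨-introˡ _ (trans (onSide-adj c a) (cong not side)))

  h-positive : ∀ k U → ∣ U ∣ ≡ k → 1 ≤ h k U
  h-positive zero    U size rewrite isEmpty-intro U (λ x → false-if (λ x∈U →
    <-irrefl (sym size) (member⇒∣∣>0 U x x∈U))) = ≤-refl
  h-positive (suc k) U size =
    let (x₀ , x₀∈U) = ∣∣≡suc⇒inhabited U size
        (x , rem) = removable-exists false U x₀∈U
        x∈U = proj₁ (removable-elim false U rem)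
    in begin
      1
        ≤⟨ h-positive k (U ∖ x) (suc-injective (trans (∣∖∣ U x x∈U) size)) ⟩
      h k (U ∖ x)
        ≤⟨ sumOn-term (removable false U) (λ y → h k (U ∖ y)) x rem ⟩
      sumOn (removable false U) (λ y → h k (U ∖ y))
        ≡⟨ up-recurrence false k U ⟨
      h (suc k) U ∎
    where open ≤-Reasoning

  module Compare (O : DiRel n) (orient : IsOrientation G O) where

    O⊆A : ∀ u v → O u v ≡ true → A u v ≡ true
    O⊆A = proj₁ orient

    O-irreflexive : Irreflexive O
    O-irreflexive x = false-if (λ o → true≢false (trans (sym (O⊆A x x o)) (irrefl G x)))

    maximal-member : ∀ {U t} → maximalIn O U t ≡ true → lookup U t ≡ true
    maximal-member {U} {t} max = proj₁ (minimal-elim (flip O) U t max)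

    maximal-elim : ∀ {U t} → maximalIn O U t ≡ true → ∀ {y} → lookup U y ≡ true → O t y ≡ false
    maximal-elim {U} {t} max {y} y∈U = proj₂ (minimal-elim (flip O) U t max) y y∈U

    -- Maximal elements of O in U are pairwise non-adjacent, since O orients
    -- every edge.
    maximal-independent : ∀ U x y → maximalIn O U x ≡ true → maximalIn O U y ≡ true → A x y ≡ false
    maximal-independent U x y max-x max-y = false-if (λ a → case (proj₁ (proj₂ orient) x y a))
      where
      case : O x y ≡ true ⊎ O y x ≡ true → ⊥
      case (inj₁ o) = true≢false (trans (sym o) (maximal-elim {U} max-x (maximal-member {U} max-y)))
      case (inj₂ o) = true≢false (trans (sym o) (maximal-elim {U} max-y (maximal-member {U} max-x)))

    maximal-bound : ∀ k U → sumOn (maximalIn O U) (λ t → h k (U ∖ t)) ≤ h (suc k) U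
    maximal-bound k U = independent-bound k U (maximalIn O U) (λ x → maximal-member {U}) (maximal-independent U)

    -- Listing from the end, the last vertex ranges over an independent set.
    extCount-≤ : ∀ k U → extCount O k U ≤ h k U
    extCount-≤ zero    U = ≤-refl
    extCount-≤ (suc k) U = begin
      extCount O (suc k) U
        ≡⟨ extCount-by-maximal O O-irreflexive k U ⟩
      sumOn (maximalIn O U) (λ t → extCount O k (U ∖ t))
        ≤⟨ sumOn-mono (maximalIn O U) (λ t _ → extCount-≤ k (U ∖ t)) ⟩
      sumOn (maximalIn O U) (λ t → h k (U ∖ t))
        ≤⟨ maximal-bound k U ⟩
      h (suc k) U ∎
      where open ≤-Reasoning

    -- If w is the only maximal vertex of U, the count for O is at most the
    -- single term h k (U ∖ w), while Oup may also remove last another vertex u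
    -- of the colour of w.
    unique-maximal-< : ∀ k U → ∣ U ∣ ≡ suc k → ∀ {u w} →
                       lookup U u ≡ true → lookup U w ≡ true → w ≢ u → col u ≡ col w →
                       (∀ t → maximalIn O U t ≡ true → t ≡ w) → extCount O (suc k) U < h (suc k) U
    unique-maximal-< k U size {u} {w} u∈U w∈U w≢u same-col only-w = begin-strict
      extCount O (suc k) U
        ≡⟨ extCount-by-maximal O O-irreflexive k U ⟩
      sumOn (maximalIn O U) (λ t → extCount O k (U ∖ t))
        ≤⟨ sumOn-mono (maximalIn O U) (λ t _ → extCount-≤ k (U ∖ t)) ⟩
      sumOn (maximalIn O U) (λ t → h k (U ∖ t))
        ≤⟨ sumOn-single (maximalIn O U) (λ t → h k (U ∖ t)) w only-w ⟩
      h k (U ∖ w)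
        <⟨ m<m+n (h k (U ∖ w)) (h-positive k (U ∖ u) size-u) ⟩
      h k (U ∖ w) + h k (U ∖ u)
        ≤⟨ sumOn-pair (removable (col w) U) (λ x → h k (U ∖ x)) w u w≢u
             (∧-intro w∈U (∨-introˡ _ (onSide-col w))) (∧-intro u∈U (∨-introˡ _ u-side)) ⟩
      sumOn (removable (col w) U) (λ x → h k (U ∖ x))
        ≡⟨ up-recurrence (col w) k U ⟨
      h (suc k) U ∎
      where
      open ≤-Reasoning
      size-u : ∣ U ∖ u ∣ ≡ k
      size-u = suc-injective (trans (∣∖∣ U u u∈U) size)
      u-side : onSide (col w) u ≡ true
      u-side = subst (λ b → onSide b u ≡ true) same-col (onSide-col u)

    -- A directed path u → v → w inside U makes the inequality strict: either
    -- some maximal t ≠ w can be removed last, keeping the path, or w is the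
    -- only maximal vertex.
    extCount-< : ∀ k U → ∣ U ∣ ≡ k → ∀ {u v w} → lookup U u ≡ true → lookup U v ≡ true →
                 lookup U w ≡ true → O u v ≡ true → O v w ≡ true → extCount O k U < h k U
    extCount-< zero U size u∈U _ _ _ _ = ⊥-elim (<-irrefl (sym size) (member⇒∣∣>0 U _ u∈U))
    extCount-< (suc k) U size {u} {v} {w} u∈U v∈U w∈U uv vw
      with any? (λ t → (maximalIn O U t Bool.≟ true) ×-dec ¬? (t ≟ w))
    ... | yes (t , max-t , t≢w) = begin-strict
      extCount O (suc k) U
        ≡⟨ extCount-by-maximal O O-irreflexive k U ⟩
      sumOn (maximalIn O U) (λ t → extCount O k (U ∖ t))
        <⟨ sumOn-mono-< (maximalIn O U) (λ t _ → extCount-≤ k (U ∖ t)) t max-t shorter ⟩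
      sumOn (maximalIn O U) (λ t → h k (U ∖ t))
        ≤⟨ maximal-bound k U ⟩
      h (suc k) U ∎
      where
      open ≤-Reasoning
      t≢u : t ≢ u
      t≢u refl = true≢false (trans (sym uv) (maximal-elim {U} max-t v∈U))
      t≢v : t ≢ v
      t≢v refl = true≢false (trans (sym vw) (maximal-elim {U} max-t w∈U))
      shorter : extCount O k (U ∖ t) < h k (U ∖ t)
      shorter = extCount-< k (U ∖ t) (suc-injective (trans (∣∖∣ U t (maximal-member {U} max-t)) size))
                  (∖-keep U t≢u u∈U) (∖-keep U t≢v v∈U) (∖-keep U t≢w w∈U) uv vw
    ... | no none =
      unique-maximal-< k U size u∈U w∈U w≢u (sym (distance-two (O⊆A u v uv) (O⊆A v w vw))) only-w
      where
      only-w : ∀ t → maximalIn O U t ≡ true → t ≡ w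
      only-w t max-t with t ≟ w
      ... | yes t≡w = t≡w
      ... | no  t≢w = ⊥-elim (none (t , max-t , t≢w))
      w≢u : w ≢ u
      w≢u refl = true≢false (trans (sym vw) (proj₂ (proj₂ orient) w v uv))

  -- In a connected bipartite graph, an orientation without directed paths of
  -- length two is Oup or Odown: around each vertex all edges point the same
  -- way, so along any walk all edges are upward or all are downward.
  module Classify (O : DiRel n) (orient : IsOrientation G O)
                  (no-path : ∀ u v w → O u v ≡ true → O v w ≡ true → ⊥) where

    -- Whether the edge {x, y} points from colour false to colour true.
    upward : Fin n → Fin n → Bool
    upward x y = O x y xor col x

    O-flip : ∀ {x y} → A x y ≡ true → O y x ≡ not (O x y)
    O-flip {x} {y} a with O x y in o
    ... | true  = proj₂ (proj₂ orient) x y o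
    ... | false with proj₁ (proj₂ orient) x y a
    ...   | inj₁ o' = ⊥-elim (true≢false (trans (sym o') o))
    ...   | inj₂ o' = o'

    upward-sym : ∀ {x y} → A x y ≡ true → upward y x ≡ upward x y
    upward-sym {x} {y} a rewrite O-flip a | col-adj a with O x y | col x
    ... | true  | true  = refl
    ... | true  | false = refl
    ... | false | true  = refl
    ... | false | false = refl

    upward-local : ∀ {x y z} → A x y ≡ true → A x z ≡ true → upward x y ≡ upward x z
    upward-local {x} {y} {z} ay az = cong (_xor col x) same
      where
      same : O x y ≡ O x z
      same with O x y in oy | O x z in oz
      ... | true  | true  = refl
      ... | false | false = refl
      ... | true  | false = ⊥-elim (no-path z x y (trans (O-flip az) (cong not oz)) oy)
      ... | false | true  = ⊥-elim (no-path y x z (trans (O-flip ay) (cong not oy)) oz)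

    upward-global : ∀ {p x} → Walk G p x → ∀ {q y} → A p q ≡ true → A x y ≡ true →
                    upward x y ≡ upward p q
    upward-global nil                  apq axy = upward-local axy apq
    upward-global (cons {p} {m} apm rest) apq axy =
      trans (upward-global rest (adj-comm apm) axy) (trans (upward-sym apm) (upward-local apm apq))

    matches : ∀ σ (P : DiRel n) → (∀ x y → P x y ≡ A x y ∧ (σ xor col x)) →
              (∀ x y → A x y ≡ true → upward x y ≡ σ) → O ≐ P
    matches σ P P-def dir x y with A x y in a
    ... | false = trans (false-if (λ o → true≢false (trans (sym (proj₁ orient x y o)) a)))
                        (sym (trans (P-def x y) (cong (_∧ _) a)))
    ... | true  = trans (solve (O x y) (col x) (dir x y a)) (sym (trans (P-def x y) (cong (_∧ _) a)))
      where
      solve : ∀ a b {c} → a xor b ≡ c → a ≡ c xor b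
      solve true  true  refl = refl
      solve true  false refl = refl
      solve false true  refl = refl
      solve false false refl = refl

    classify : Connected G → (O ≐ up) ⊎ (O ≐ down)
    classify conn with any? (λ p → any? (λ q → A p q Bool.≟ true))
    ... | no no-edge = inj₁ (matches true up up-succ (λ x y a → ⊥-elim (no-edge (x , y , a))))
    ... | yes (p , q , apq) with upward p q in dir
    ...   | true  = inj₁ (matches true  up   up-succ   (λ x y a → trans (upward-global (conn p x) apq a) dir))
    ...   | false = inj₂ (matches false down down-succ (λ x y a → trans (upward-global (conn p x) apq a) dir))

concatF : ∀ {m} {A : Set} → (Fin m → List A) → List A
concatF {zero}  f = []
concatF {suc m} f = f zero ++ concatF (λ i → f (suc i))

module _ {A : Set} where

  length-concatF : ∀ {m} (f : Fin m → List A) → length (concatF f) ≡ sum (λ i → length (f i))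
  length-concatF {zero}  f = refl
  length-concatF {suc m} f =
    trans (length-++ (f zero)) (cong (length (f zero) +_) (length-concatF (λ i → f (suc i))))

  ∈-concatF⁻ : ∀ {m} (f : Fin m → List A) {x} → x ∈ concatF f → ∃ λ i → x ∈ f i
  ∈-concatF⁻ {suc m} f p with ∈-++⁻ (f zero) p
  ... | inj₁ q = zero , q
  ... | inj₂ q = let (i , r) = ∈-concatF⁻ (λ j → f (suc j)) q in suc i , r

  ∈-concatF⁺ : ∀ {m} (f : Fin m → List A) {x} i → x ∈ f i → x ∈ concatF f
  ∈-concatF⁺ f zero    p = ∈-++⁺ˡ p
  ∈-concatF⁺ f (suc i) p = ∈-++⁺ʳ (f zero) (∈-concatF⁺ (λ j → f (suc j)) i p)

  unique-concatF : ∀ {m} (f : Fin m → List A) → (∀ i → Unique (f i)) →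
                   (∀ i j {x} → x ∈ f i → x ∈ f j → i ≡ j) → Unique (concatF f)
  unique-concatF {zero}  f u d = []
  unique-concatF {suc m} f u d =
    Unique.++⁺ (u zero)
      (unique-concatF (λ j → f (suc j)) (λ j → u (suc j))
                      (λ i j p q → Fin.suc-injective (d (suc i) (suc j) p q)))
      (λ (p , q) → let (i , r) = ∈-concatF⁻ (λ j → f (suc j)) q in Fin.0≢1+n (d zero (suc i) p r))

  length-if : ∀ b (xs : List A) → length (if b then xs else []) ≡ ind b (length xs)
  length-if true  xs = refl
  length-if false xs = refl

  ∈-if : ∀ b (xs : List A) {x} → x ∈ (if b then xs else []) → b ≡ true × x ∈ xs
  ∈-if true xs p = refl , p

module _ {n : ℕ} (O : DiRel n) where

  record IsListing (k : ℕ) (U : Subset n) (w : Vec (Fin n) k) : Set where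
    field
      inU      : ∀ i → lookup U (lookup w i) ≡ true
      covers   : ∀ v → lookup U v ≡ true → ∃ λ i → lookup w i ≡ v
      distinct : ∀ i j → lookup w i ≡ lookup w j → i ≡ j
      respects : ∀ i j → i <ᶠ j → O (lookup w j) (lookup w i) ≡ false

  cons-listing : ∀ {k U s w} → minimalIn O U s ≡ true → IsListing k (U ∖ s) w →
                 IsListing (suc k) U (s ∷ w)
  cons-listing {k} {U} {s} {w} min-s L = record
    { inU      = λ { zero → s∈U ; (suc i) → ∖-⊆ U (inU i) }
    ; covers   = covers'
    ; distinct = distinct'
    ; respects = respects' }
    where
    open IsListing L
    s∈U : lookup U s ≡ true
    s∈U = proj₁ (minimal-elim O U s min-s)
    s∉w : ∀ i → s ≢ lookup w i
    s∉w i e = true≢false (trans (sym (inU i)) (trans (cong (lookup (U ∖ s)) (sym e)) (∖-self U s)))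
    covers' : ∀ v → lookup U v ≡ true → ∃ λ i → lookup (s ∷ w) i ≡ v
    covers' v v∈U with s ≟ v
    ... | yes s≡v = zero , s≡v
    ... | no  s≢v = let (i , e) = covers v (∖-keep U s≢v v∈U) in suc i , e
    distinct' : ∀ i j → lookup (s ∷ w) i ≡ lookup (s ∷ w) j → i ≡ j
    distinct' zero    zero    e = refl
    distinct' zero    (suc j) e = ⊥-elim (s∉w j e)
    distinct' (suc i) zero    e = ⊥-elim (s∉w i (sym e))
    distinct' (suc i) (suc j) e = cong suc (distinct i j e)
    respects' : ∀ i j → i <ᶠ j → O (lookup (s ∷ w) j) (lookup (s ∷ w) i) ≡ false
    respects' zero    (suc j) _       = proj₂ (minimal-elim O U s min-s) (lookup w j) (∖-⊆ U (inU j))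
    respects' (suc i) (suc j) (s≤s lt) = respects i j lt

  uncons-listing : Irreflexive O → ∀ {k U s w} → IsListing (suc k) U (s ∷ w) →
                   minimalIn O U s ≡ true × IsListing k (U ∖ s) w
  uncons-listing irr {k} {U} {s} {w} L = min-s , record
    { inU      = λ i → ∖-keep U (λ e → Fin.0≢1+n (distinct zero (suc i) e)) (inU (suc i))
    ; covers   = covers'
    ; distinct = λ i j e → Fin.suc-injective (distinct (suc i) (suc j) e)
    ; respects = λ i j lt → respects (suc i) (suc j) (s≤s lt) }
    where
    open IsListing L
    min-s : minimalIn O U s ≡ true
    min-s = minimal-intro O U s (inU zero) noPred
      where
      noPred : ∀ y → lookup U y ≡ true → O y s ≡ false
      noPred y y∈U with covers y y∈U
      ... | zero  , refl = irr s
      ... | suc j , refl = respects zero (suc j) (s≤s z≤n)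
    covers' : ∀ v → lookup (U ∖ s) v ≡ true → ∃ λ i → lookup w i ≡ v
    covers' v v∈U∖s with covers v (∖-⊆ U v∈U∖s)
    ... | zero  , refl = ⊥-elim (∖-≢ U v∈U∖s refl)
    ... | suc i , e    = i , e

  empty-listing : ∀ {U} → isEmpty U ≡ true → IsListing 0 U []
  empty-listing {U} e = record
    { inU = λ () ; distinct = λ () ; respects = λ ()
    ; covers = λ v v∈U → ⊥-elim (true≢false (trans (sym v∈U) (isEmpty-elim U e v))) }

  listing-empty : ∀ {U} → IsListing 0 U [] → isEmpty U ≡ true
  listing-empty {U} L = isEmpty-intro U (λ v → false-if (λ v∈U → no-index (IsListing.covers L v v∈U)))
    where
    no-index : ∀ {v} → ∃ (λ (i : Fin 0) → lookup [] i ≡ v) → ⊥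
    no-index (() , _)

  starting : ∀ {k} → Subset n → Fin n → List (Vec (Fin n) k) → List (Vec (Fin n) (suc k))
  starting U s rest = if minimalIn O U s then map (s ∷_) rest else []

  listings : (k : ℕ) → Subset n → List (Vec (Fin n) k)
  listings zero    U = if isEmpty U then [] ∷ [] else []
  listings (suc k) U = concatF (λ s → starting U s (listings k (U ∖ s)))

  length-listings : ∀ k U → length (listings k U) ≡ extCount O k U
  length-listings zero    U = length-if (isEmpty U) ([] ∷ [])
  length-listings (suc k) U =
    trans (length-concatF (λ s → starting U s (listings k (U ∖ s)))) (sum-cong-≗ {n} (λ s →
      trans (length-if (minimalIn O U s) (map (s ∷_) (listings k (U ∖ s))))
            (cong (ind (minimalIn O U s))
                  (trans (length-map (s ∷_) (listings k (U ∖ s))) (length-listings k (U ∖ s))))))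

  listings-sound : ∀ k U w → w ∈ listings k U → IsListing k U w
  listings-sound zero    U [] p = empty-listing (proj₁ (∈-if (isEmpty U) _ p))
  listings-sound (suc k) U w p =
    let (s , q) = ∈-concatF⁻ _ p
        (min-s , r) = ∈-if (minimalIn O U s) _ q
        (w' , w'∈ , w≡s∷w') = ∈-map⁻ (s ∷_) r
    in subst (IsListing (suc k) U) (sym w≡s∷w') (cons-listing min-s (listings-sound k (U ∖ s) w' w'∈))

  listings-complete : Irreflexive O → ∀ k U w → IsListing k U w → w ∈ listings k U
  listings-complete irr zero    U [] L rewrite listing-empty L = here refl
  listings-complete irr (suc k) U (s ∷ w) L with uncons-listing irr L
  ... | min-s , L' =
    ∈-concatF⁺ (λ t → starting U t (listings k (U ∖ t))) s
      (subst (λ b → s ∷ w ∈ (if b then map (s ∷_) (listings k (U ∖ s)) else [])) (sym min-s)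
             (∈-map⁺ (s ∷_) (listings-complete irr k (U ∖ s) w L')))

  listings-unique : ∀ k U → Unique (listings k U)
  listings-unique zero    U with isEmpty U
  ... | true  = [] ∷ []
  ... | false = []
  listings-unique (suc k) U = unique-concatF _ (λ s → guarded (minimalIn O U s) s)
    (λ s t p q → heads-agree (∈-map⁻ (s ∷_) (proj₂ (∈-if _ _ p))) (∈-map⁻ (t ∷_) (proj₂ (∈-if _ _ q))))
    where
    guarded : ∀ b s → Unique (if b then map (s ∷_) (listings k (U ∖ s)) else [])
    guarded true  s = Unique.map⁺ (λ e → proj₂ (∷-injective e)) (listings-unique k (U ∖ s))
    guarded false s = []
    heads-agree : ∀ {s t x} → (∃ λ w → w ∈ listings k (U ∖ s) × x ≡ s ∷ w) →
                  (∃ λ w → w ∈ listings k (U ∖ t) × x ≡ t ∷ w) → s ≡ t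
    heads-agree (_ , _ , refl) (_ , _ , e) = proj₁ (∷-injective e)

unique-lookup : ∀ {A : Set} {xs : List A} → Unique xs →
                ∀ i j → List.lookup xs i ≡ List.lookup xs j → i ≡ j
unique-lookup (_ ∷ _) zero zero e = refl
unique-lookup {xs = _ ∷ xs} (x∉ ∷ _) zero (suc j) e = ⊥-elim (All.lookup x∉ (∈-lookup j) e)
unique-lookup {xs = _ ∷ xs} (x∉ ∷ _) (suc i) zero e = ⊥-elim (All.lookup x∉ (∈-lookup i) (sym e))
unique-lookup (_ ∷ u) (suc i) (suc j) e = cong suc (unique-lookup u i j e)

module _ {n : ℕ} (O : DiRel n) (irr : Irreflexive O) where

  module FromListing {w : Vec (Fin n) n} (L : IsListing O n ⊤ w) where
    open IsListing L

    position : Fin n → Fin n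
    position v = proj₁ (covers v (⊤-∋ v))

    position-spec : ∀ v → lookup w (position v) ≡ v
    position-spec v = proj₂ (covers v (⊤-∋ v))

    position-unique : ∀ {i v} → lookup w i ≡ v → position v ≡ i
    position-unique e = distinct _ _ (trans (position-spec _) (sym e))

    linExt : LinExt O
    linExt = position , (injective , surjective) , monotone
      where
      injective : ∀ {u v} → position u ≡ position v → u ≡ v
      injective {u} {v} e = trans (sym (position-spec u)) (trans (cong (lookup w) e) (position-spec v))
      surjective : ∀ i → ∃ λ v → ∀ {z} → z ≡ v → position z ≡ i
      surjective i = lookup w i , λ { refl → position-unique refl }
      monotone : ∀ u v → O u v ≡ true → position u <ᶠ position v
      monotone u v o with Fin.<-cmp (position u) (position v)
      ... | tri< lt _ _ = lt
      ... | tri≈ _ e _ =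
        ⊥-elim (true≢false (trans (sym o) (trans (cong (λ x → O x v) (injective e)) (irr v))))
      ... | tri> _ _ gt = ⊥-elim (true≢false (trans (sym o)
        (subst₂ (λ x y → O x y ≡ false) (position-spec u) (position-spec v) (respects _ _ gt))))

  toListing : (a : LinExt O) → ∃ λ w → Σ (IsListing O n ⊤ w) λ L → FromListing.linExt L ≈LE a
  toListing (f , (f-inj , f-surj) , f-mono) = tabulate g , L , agree
    where
    g : Fin n → Fin n
    g i = proj₁ (f-surj i)
    f∘g : ∀ i → f (g i) ≡ i
    f∘g i = proj₂ (f-surj i) refl
    g∘f : ∀ v → g (f v) ≡ v
    g∘f v = f-inj (f∘g (f v))
    g-injective : ∀ {i j} → g i ≡ g j → i ≡ j
    g-injective {i} {j} e = trans (sym (f∘g i)) (trans (cong f e) (f∘g j))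
    g-respects : ∀ i j → i <ᶠ j → O (g j) (g i) ≡ false
    g-respects i j i<j = false-if (λ o → Fin.<-asym i<j (subst₂ _<ᶠ_ (f∘g j) (f∘g i) (f-mono _ _ o)))
    w-at : ∀ i → lookup (tabulate g) i ≡ g i
    w-at = lookup∘tabulate g
    L : IsListing O n ⊤ (tabulate g)
    L = record
      { inU      = λ i → ⊤-∋ {n} (lookup (tabulate g) i)
      ; covers   = λ v _ → f v , trans (w-at (f v)) (g∘f v)
      ; distinct = λ i j e → g-injective (trans (sym (w-at i)) (trans e (w-at j)))
      ; respects = λ i j i<j → subst₂ (λ x y → O x y ≡ false) (sym (w-at j)) (sym (w-at i)) (g-respects i j i<j) }
    agree : FromListing.linExt L ≈LE (f , (f-inj , f-surj) , f-mono)
    agree v = FromListing.position-unique L (trans (w-at (f v)) (g∘f v))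

  listing-determined : ∀ {w w'} (L : IsListing O n ⊤ w) (L' : IsListing O n ⊤ w') →
                       FromListing.linExt L ≈LE FromListing.linExt L' → w ≡ w'
  listing-determined {w} {w'} L L' same = begin
    w                   ≡⟨ tabulate∘lookup w ⟨
    tabulate (lookup w) ≡⟨ tabulate-cong entries ⟩
    tabulate (lookup w') ≡⟨ tabulate∘lookup w' ⟩
    w' ∎
    where
    open ≡-Reasoning
    entries : ∀ i → lookup w i ≡ lookup w' i
    entries i = trans (sym (FromListing.position-spec L' (lookup w i)))
      (cong (lookup w') (trans (sym (same (lookup w i))) (FromListing.position-unique L refl)))

record Enumeration {n : ℕ} (O : DiRel n) (N : ℕ) : Set where
  field
    enum     : Fin N → LinExt O
    distinct : ∀ i j → _≈LE_ {O = O} {O' = O} (enum i) (enum j) → i ≡ j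
    complete : ∀ a → ∃ λ i → _≈LE_ {O = O} {O' = O} (enum i) a

enumeration : ∀ {n} (O : DiRel n) → Irreflexive O → Enumeration O (extCount O n ⊤)
enumeration {n} O irr = subst (Enumeration O) (length-listings O n ⊤) record
  { enum     = enum
  ; distinct = λ i j e →
      unique-lookup (listings-unique O n ⊤) i j (listing-determined O irr (listing i) (listing j) e)
  ; complete = complete }
  where
  Ls : List (Vec (Fin n) n)
  Ls = listings O n ⊤
  listing : ∀ i → IsListing O n ⊤ (List.lookup Ls i)
  listing i = listings-sound O n ⊤ _ (∈-lookup i)
  enum : Fin (length Ls) → LinExt O
  enum i = FromListing.linExt O irr (listing i)
  complete : ∀ a → ∃ λ i → _≈LE_ {O = O} {O' = O} (enum i) a
  complete a =
    let (w , L , agree) = toListing O irr a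
        w∈ = listings-complete O irr n ⊤ w L
        i = Any.index w∈
    in i , λ v → trans (FromListing.position-unique O irr (listing i)
                          (trans (cong (λ x → lookup x (FromListing.position O irr L v)) (sym (lookup-index w∈)))
                                 (FromListing.position-spec O irr L v)))
                       (agree v)

module Transfer {n : ℕ} {O O' : DiRel n} {N N' : ℕ}
                (E : Enumeration O N) (E' : Enumeration O' N') (N≤N' : N ≤ N') where

  module E  = Enumeration E
  module E' = Enumeration E'

  index : LinExt O → Fin N
  index a = proj₁ (E.complete a)

  index-spec : ∀ a → E.enum (index a) ≈LE a
  index-spec a = proj₂ (E.complete a)

  index-cong : ∀ a b → a ≈LE b → index a ≡ index b
  index-cong a b a≈b = E.distinct _ _ (λ v → trans (index-spec a v) (trans (a≈b v) (sym (index-spec b v))))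

  embed : Fin N → Fin N'
  embed i = inject≤ i N≤N'

  Θ : LinExt O → LinExt O'
  Θ a = E'.enum (embed (index a))

  Θ-well-defined : WellDefined Θ
  Θ-well-defined a b a≈b v = cong (λ i → proj₁ (E'.enum (embed i)) v) (index-cong a b a≈b)

  Θ-injective : InjectiveLE Θ
  Θ-injective a b Θa≈Θb v =
    trans (sym (index-spec a v)) (trans (cong (λ i → proj₁ (E.enum i) v) same-index) (index-spec b v))
    where
    same-index : index a ≡ index b
    same-index = toℕ-injective (trans (sym (toℕ-inject≤ (index a) N≤N'))
                   (trans (cong toℕ (E'.distinct _ _ Θa≈Θb)) (toℕ-inject≤ (index b) N≤N')))

  -- A surjective Θ yields an injection Fin N' → Fin N.
  surjective⇒≥ : SurjectiveLE Θ → N' ≤ N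
  surjective⇒≥ surj = injective⇒≤ {f = λ j → index (preimage j)} (λ {i} {j} e → E'.distinct i j (λ v →
      trans (sym (preimage-spec i v)) (trans (cong (λ k → proj₁ (E'.enum (embed k)) v) e) (preimage-spec j v))))
    where
    preimage : Fin N' → LinExt O
    preimage j = proj₁ (surj (E'.enum j))
    preimage-spec : ∀ j → Θ (preimage j) ≈LE E'.enum j
    preimage-spec j = proj₂ (surj (E'.enum j))

  equal⇒surjective : N ≡ N' → SurjectiveLE Θ
  equal⇒surjective N≡N' b =
    E.enum i , λ v → trans (cong (λ k → proj₁ (E'.enum k) v) hits-j) (proj₂ (E'.complete b) v)
    where
    j : Fin N'
    j = proj₁ (E'.complete b)
    i : Fin N
    i = fromℕ< (subst (toℕ j <_) (sym N≡N') (toℕ<n j))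
    hits-j : embed (index (E.enum i)) ≡ j
    hits-j = toℕ-injective (trans (toℕ-inject≤ _ N≤N')
               (trans (cong toℕ (E.distinct _ i (index-spec (E.enum i)))) (toℕ-fromℕ< _)))

theorem2p6 : (n : ℕ) (G : SimpleGraph n) (col : Fin n → Bool) →
    Connected G → IsBipartition G col →
    (O : DiRel n) → IsAcyclicOrientation G O →
    Σ (LinExt O → LinExt (Oup G col)) λ Θ →
      WellDefined Θ × InjectiveLE Θ ×
      (SurjectiveLE Θ ⇔ ((O ≐ Oup G col) ⊎ (O ≐ Odown G col)))
theorem2p6 n G col conn bip O (orient , _) =
  Θ , Θ-well-defined , Θ-injective , mk⇔ surjective⇒bipartite bipartite⇒surjective
  where
  open Bipartite G col bip
  open Compare O orient
  open Transfer (enumeration O O-irreflexive) (enumeration up up-irreflexive) (extCount-≤ n ⊤)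

  -- Equality of the counts rules out directed paths of length two.
  surjective⇒bipartite : SurjectiveLE Θ → (O ≐ up) ⊎ (O ≐ down)
  surjective⇒bipartite surj = Classify.classify O orient no-path conn
    where
    no-path : ∀ u v w → O u v ≡ true → O v w ≡ true → ⊥
    no-path u v w uv vw =
      <⇒≱ (extCount-< n ⊤ (∣⊤∣≡n n) (⊤-∋ u) (⊤-∋ v) (⊤-∋ w) uv vw) (surjective⇒≥ surj)

  bipartite⇒surjective : (O ≐ up) ⊎ (O ≐ down) → SurjectiveLE Θ
  bipartite⇒surjective (inj₁ O≐up)   = equal⇒surjective (extCount-cong O≐up n ⊤)
  bipartite⇒surjective (inj₂ O≐down) =
    equal⇒surjective (trans (extCount-cong O≐down n ⊤) (extCount-down n ⊤))
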